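{- Let $G$ be a graph, $k,\ell\ge1$, $S$ an independent set of size $k$, and $J_0=S,J_1,\dots,J_\ell$ independent sets of $G$. Define $\mathcal{C}_0=\{\{(S,k)\}\}$ and, for $i\in\{1,\dots,\ell\}$, let $\mathcal{C}_i$ contain, for every $C\in\mathcal{C}_{i-1}$ and every $(X,b)\in C$, the constraint set consisting of $(N(X)\cap J_i,1)$, of $(X\cap J_i,b-1)$ if $b\ge 2$ (nothing if $b=1$), and of $(X'\cap J_i,b')$ for every other $(X',b')\in C$. Then for every $i\in\{0,\dots,\ell\}$: if an independent set $Z\subseteq J_i$ with $|Z|=k$ satisfies at least one constraint set in $\mathcal{C}_i$, then $Z$ is reachable from $S$ by a sequence of token slides.
   Context: A constraint is a pair $(X,b)$ with $X\subseteq V(G)$ and $b$ a positive integer; $Z\subseteq V(G)$ satisfies $(X,b)$ if $|Z\cap X|=b$, and satisfies a constraint set if it satisfies all its constraints. $N(X)$ is the set of vertices outside $X$ adjacent to some vertex of $X$. A token slide transforms an independent set $I$ into $I'=(I\setminus\{u\})\cup\{v\}$ with $u\in I$, $v\notin I$, $\{u,v\}\in E(G)$, and $I'$ independent. -}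

module Defs where

open import Data.Nat using (ℕ; zero; suc; _≤_; _∸_)
open import Data.Bool using (Bool; true; false; not; _∧_; _∨_)
open import Data.Fin using (Fin; zero; suc)
open import Data.Vec using (tabulate; lookup)
open import Data.Fin.Subset using (Subset; _∈_; _∉_; _∩_; _∪_; _-_; ⁅_⁆)
open import Data.Product using (_×_; _,_; Σ)
open import Data.Sum using (_⊎_)
open import Relation.Binary.PropositionalEquality using (_≡_; _≢_)
open import Relation.Binary.Construct.Closure.ReflexiveTransitive using (Star)

record Graph : Set where
  field
    n      : ℕ
    adj    : Fin n → Fin n → Bool
    sym    : ∀ u v → adj u v ≡ adj v u
    irrefl : ∀ v → adj v v ≡ false
open Graph public

anyFin : ∀ {m} → (Fin m → Bool) → Bool
anyFin {zero}  f = false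
anyFin {suc m} f = f zero ∨ anyFin (λ i → f (suc i))

module _ (G : Graph) where

  V : Set
  V = Fin (n G)

  N : Subset (n G) → Subset (n G)
  N X = tabulate (λ v → not (lookup X v) ∧ anyFin (λ u → lookup X u ∧ adj G u v))

  Independent : Subset (n G) → Set
  Independent I = ∀ u v → u ∈ I → v ∈ I → adj G u v ≡ false

  Slide : Subset (n G) → Subset (n G) → Set
  Slide I I' = Σ V λ u → Σ V λ v →
    u ∈ I × v ∉ I × adj G u v ≡ true ×
    I' ≡ (I - u) ∪ ⁅ v ⁆ × Independent I'

  Reachable : Subset (n G) → Subset (n G) → Set
  Reachable = Star Slide

  Constraint : Set
  Constraint = Subset (n G) × ℕ

  ConstraintSet : Set₁
  ConstraintSet = Constraint → Set

  satisfies : Subset (n G) → Constraint → Set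
  satisfies Z (X , b) = Data.Fin.Subset.∣ Z ∩ X ∣ ≡ b

  satisfiesSet : Subset (n G) → ConstraintSet → Set
  satisfiesSet Z C = ∀ c → C c → satisfies Z c

  branch : Subset (n G) → ConstraintSet → Constraint → ConstraintSet
  branch J C (X , b) c =
    (c ≡ (N X ∩ J , 1))
    ⊎ ((2 ≤ b × c ≡ (X ∩ J , b ∸ 1))
    ⊎ Σ Constraint λ c' → C c' × c' ≢ (X , b) × c ≡ (Data.Product.proj₁ c' ∩ J , Data.Product.proj₂ c'))

  data 𝒞 (J : ℕ → Subset (n G)) (S : Subset (n G)) (k : ℕ) : ℕ → ConstraintSet → Set₁ where
    base : 𝒞 J S k 0 (λ c → c ≡ (S , k))
    step : ∀ {i C} (c : Constraint) → 𝒞 J S k i C → C c → 𝒞 J S k (suc i) (branch (J (suc i)) C c)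

module Submission where

-- Every C ∈ 𝒞ᵢ either demands a token from an empty set, and then nothing satisfies it, or it
-- is a finite family of pairwise disjoint subsets of Jᵢ with positive demands summing to k; by
-- counting, a k-set satisfying such a family lies inside its union.  Branching preserves this
-- dichotomy, and it drives the induction on i.  If Z ⊆ Jᵢ₊₁ satisfies the branch of C at (X , b),
-- Z has exactly one token v in N(X), adjacent to some u ∈ X outside Z.  Sliding v back to u gives
-- Z′ ⊆ Jᵢ: u supplies the b-th token of X, while u and v avoid every other set of C (by
-- disjointness from X and independence of Jᵢ).  So Z′ satisfies C, is reachable by induction,
-- and the slide u → v leads from Z′ to Z.

open import Defs hiding (sym)
open import Data.Nat using (ℕ; zero; suc; _+_; _∸_; _≤_; _<_; z≤n; s≤s)
open import Data.Nat.Properties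
  using ( module ≤-Reasoning; _≤?_; ≰⇒>; m≤n⇒m≤1+n; m≤n⇒m∸n≡0; m+[n∸m]≡n
        ; +-comm; +-identityʳ; +-suc; ≤-pred; ≤-trans; ≤-refl; ≤-reflexive; <-irrefl)
open import Data.Bool using (Bool; true; false; not; _∧_)
open import Data.Bool.Properties using (∧-conicalˡ; ∧-conicalʳ)
open import Data.Fin using (Fin; zero; suc; _≟_)
open import Data.Fin.Subset
  using (Subset; inside; outside; _∈_; _∉_; _⊆_; _∩_; _∪_; _─_; _-_; ⁅_⁆; ⋃; ∣_∣; Empty; Nonempty)
open import Data.Fin.Subset.Properties
open import Data.Vec using ([]; _∷_; here; there; lookup)
open import Data.Vec.Properties using (lookup∘tabulate; []=⇒lookup; lookup⇒[]=)
open import Data.List using (List; []; _∷_; _++_; [_]; map)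
open import Data.List.Properties using (map-∘; map-cong-local)
open import Data.List.Membership.Propositional using (find) renaming (_∈_ to _∈ₗ_)
open import Data.List.Membership.Propositional.Properties
  using (∈-∃++; ∈-map⁺; ∈-map⁻; ∈-++⁺ˡ; ∈-++⁺ʳ; ∈-++⁻)
open import Data.List.Relation.Unary.All as All using (All; []; _∷_)
import Data.List.Relation.Unary.All.Properties as Allₚ
open import Data.List.Relation.Unary.Any using (Any; here; there)
import Data.List.Relation.Unary.Any.Properties as Anyₚ
open import Data.List.Relation.Unary.AllPairs as AllPairs using (AllPairs; []; _∷_)
import Data.List.Relation.Unary.AllPairs.Properties as AllPairsₚ
open import Data.Nat.ListAction using (sum)
open import Data.Nat.ListAction.Properties using (sum-↭)
open import Data.List.Relation.Binary.Permutation.Propositional using (_↭_; ↭-sym; ↭⇒↭ₛ)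
open import Data.List.Relation.Binary.Permutation.Propositional.Properties
  using (∈-resp-↭; All-resp-↭; map⁺; shift)
import Data.List.Relation.Binary.Permutation.Setoid.Properties as PermutationSetoid
open import Data.Product using (Σ; _×_; _,_; proj₁; proj₂; ∃; uncurry)
open import Data.Sum using (_⊎_; inj₁; inj₂)
open import Relation.Binary.Construct.Closure.ReflexiveTransitive using (ε; _◅_; _◅◅_)
open import Function using (_∘_; _on_)
open import Relation.Nullary using (¬_; yes; no; contradiction)
open import Relation.Binary.PropositionalEquality
  using (_≡_; _≢_; refl; sym; trans; cong; subst; resp₂; setoid; module ≡-Reasoning)

private
  variable
    A : Set
    m : ℕ
    p q r : Subset m
    x y z : Fin m

Disjoint : Subset m → Subset m → Set
Disjoint p q = ∀ x → x ∈ p → x ∉ q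

Disjoint-sym : Disjoint p q → Disjoint q p
Disjoint-sym p#q x x∈q x∈p = p#q x x∈p x∈q

p⊆r⇒p∩[q∩r]≡p∩q : p ⊆ r → p ∩ (q ∩ r) ≡ p ∩ q
p⊆r⇒p∩[q∩r]≡p∩q {p = p} {r} {q} p⊆r = ⊆-antisym
  (λ x∈ → let x∈p , x∈q∩r = x∈p∩q⁻ p _ x∈ in x∈p∩q⁺ (x∈p , proj₁ (x∈p∩q⁻ q r x∈q∩r)))
  (λ x∈ → let x∈p , x∈q = x∈p∩q⁻ p q x∈ in x∈p∩q⁺ (x∈p , x∈p∩q⁺ (x∈q , p⊆r x∈p)))

Disjoint-∩ : Disjoint p q → Disjoint (p ∩ r) (q ∩ r)
Disjoint-∩ {p = p} {q} {r} p#q x x∈p∩r x∈q∩r = p#q x (proj₁ (x∈p∩q⁻ p r x∈p∩r)) (proj₁ (x∈p∩q⁻ q r x∈q∩r))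

Empty-∩ : Empty p → Empty (p ∩ q)
Empty-∩ {p = p} {q} p-empty (x , x∈p∩q) = p-empty (x , proj₁ (x∈p∩q⁻ p q x∈p∩q))

x∈p─q⁻ : x ∈ p ─ q → x ∈ p × x ∉ q
x∈p─q⁻ {x = zero} {inside ∷ p} {outside ∷ q} here = here , λ ()
x∈p─q⁻ {x = zero} {inside ∷ p} {inside ∷ q} ()
x∈p─q⁻ {x = zero} {outside ∷ p} {inside ∷ q} ()
x∈p─q⁻ {x = zero} {outside ∷ p} {outside ∷ q} ()
x∈p─q⁻ {p = s ∷ p} {t ∷ q} (there x∈p─q) with x∈p─q⁻ x∈p─q
... | x∈p , x∉q = there x∈p , λ { (there x∈q) → x∉q x∈q }

x∈p-y⁻ : x ∈ p - y → x ∈ p × x ≢ y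
x∈p-y⁻ {y = y} x∈p-y with x∈p─q⁻ x∈p-y
... | x∈p , x∉⁅y⁆ = x∈p , x∉⁅y⁆⇒x≢y x∉⁅y⁆

∣p∪q∣≡∣p∣+∣q∣ : Disjoint p q → ∣ p ∪ q ∣ ≡ ∣ p ∣ + ∣ q ∣
∣p∪q∣≡∣p∣+∣q∣ {p = []} {[]} _ = refl
∣p∪q∣≡∣p∣+∣q∣ {p = inside ∷ p} {inside ∷ q} p#q = contradiction here (p#q zero here)
∣p∪q∣≡∣p∣+∣q∣ {p = inside ∷ p} {outside ∷ q} p#q =
  cong suc (∣p∪q∣≡∣p∣+∣q∣ (λ x x∈p x∈q → p#q (suc x) (there x∈p) (there x∈q)))
∣p∪q∣≡∣p∣+∣q∣ {p = outside ∷ p} {inside ∷ q} p#q = begin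
  suc ∣ p ∪ q ∣       ≡⟨ cong suc (∣p∪q∣≡∣p∣+∣q∣ (λ x x∈p x∈q → p#q (suc x) (there x∈p) (there x∈q))) ⟩
  suc (∣ p ∣ + ∣ q ∣) ≡⟨ sym (+-suc ∣ p ∣ ∣ q ∣) ⟩
  ∣ p ∣ + suc ∣ q ∣   ∎
  where open ≡-Reasoning
∣p∪q∣≡∣p∣+∣q∣ {p = outside ∷ p} {outside ∷ q} p#q =
  ∣p∪q∣≡∣p∣+∣q∣ (λ x x∈p x∈q → p#q (suc x) (there x∈p) (there x∈q))

p⊆q∧∣q∣≤∣p∣⇒p≡q : p ⊆ q → ∣ q ∣ ≤ ∣ p ∣ → p ≡ q
p⊆q∧∣q∣≤∣p∣⇒p≡q {p = []} {[]} _ _ = refl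
p⊆q∧∣q∣≤∣p∣⇒p≡q {p = inside ∷ p} {inside ∷ q} p⊆q ∣q∣≤∣p∣ =
  cong (inside ∷_) (p⊆q∧∣q∣≤∣p∣⇒p≡q (drop-∷-⊆ p⊆q) (≤-pred ∣q∣≤∣p∣))
p⊆q∧∣q∣≤∣p∣⇒p≡q {p = inside ∷ p} {outside ∷ q} p⊆q _ with p⊆q here
... | ()
p⊆q∧∣q∣≤∣p∣⇒p≡q {p = outside ∷ p} {inside ∷ q} p⊆q ∣q∣≤∣p∣ =
  contradiction (≤-trans ∣q∣≤∣p∣ (p⊆q⇒∣p∣≤∣q∣ (drop-∷-⊆ p⊆q))) (<-irrefl refl)
p⊆q∧∣q∣≤∣p∣⇒p≡q {p = outside ∷ p} {outside ∷ q} p⊆q ∣q∣≤∣p∣ =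
  cong (outside ∷_) (p⊆q∧∣q∣≤∣p∣⇒p≡q (drop-∷-⊆ p⊆q) ∣q∣≤∣p∣)

Empty⇒∣p∣≡0 : {p : Subset m} → Empty p → ∣ p ∣ ≡ 0
Empty⇒∣p∣≡0 {m = m} empty = trans (cong ∣_∣ (Empty-unique empty)) (∣⊥∣≡0 m)

∣p∣>0⇒Nonempty : 0 < ∣ p ∣ → Nonempty p
∣p∣>0⇒Nonempty {p = p} 0<∣p∣ with nonempty? p
... | yes nonempty = nonempty
... | no empty = contradiction 0<∣p∣ (<-irrefl (sym (Empty⇒∣p∣≡0 empty)))

∣p∪⁅x⁆∣≡1+∣p∣ : x ∉ p → ∣ p ∪ ⁅ x ⁆ ∣ ≡ suc ∣ p ∣
∣p∪⁅x⁆∣≡1+∣p∣ {x = x} {p = p} x∉p = begin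
  ∣ p ∪ ⁅ x ⁆ ∣     ≡⟨ ∣p∪q∣≡∣p∣+∣q∣ (λ w w∈p w∈⁅x⁆ → x∉p (subst (_∈ p) (x∈⁅y⁆⇒x≡y x w∈⁅x⁆) w∈p)) ⟩
  ∣ p ∣ + ∣ ⁅ x ⁆ ∣ ≡⟨ cong (∣ p ∣ +_) (∣⁅x⁆∣≡1 x) ⟩
  ∣ p ∣ + 1         ≡⟨ +-comm ∣ p ∣ 1 ⟩
  suc ∣ p ∣         ∎
  where open ≡-Reasoning

∣p∣≡1⇒x∈p∧y∈p⇒x≡y : ∣ p ∣ ≡ 1 → x ∈ p → y ∈ p → x ≡ y
∣p∣≡1⇒x∈p∧y∈p⇒x≡y {p = p} {x} {y} ∣p∣≡1 x∈p y∈p with x ≟ y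
... | yes x≡y = x≡y
... | no x≢y = contradiction (≤-trans 2≤∣p∣ (≤-reflexive ∣p∣≡1)) λ { (s≤s ()) }
  where
  ⁅x⁆∪⁅y⁆⊆p : ⁅ x ⁆ ∪ ⁅ y ⁆ ⊆ p
  ⁅x⁆∪⁅y⁆⊆p w∈ with x∈p∪q⁻ ⁅ x ⁆ ⁅ y ⁆ w∈
  ... | inj₁ w∈⁅x⁆ = subst (_∈ p) (sym (x∈⁅y⁆⇒x≡y x w∈⁅x⁆)) x∈p
  ... | inj₂ w∈⁅y⁆ = subst (_∈ p) (sym (x∈⁅y⁆⇒x≡y y w∈⁅y⁆)) y∈p
  2≤∣p∣ : 2 ≤ ∣ p ∣
  2≤∣p∣ = subst (_≤ ∣ p ∣) (trans (∣p∪⁅x⁆∣≡1+∣p∣ (x≢y⇒x∉⁅y⁆ (x≢y ∘ sym))) (cong suc (∣⁅x⁆∣≡1 x)))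
                (p⊆q⇒∣p∣≤∣q∣ ⁅x⁆∪⁅y⁆⊆p)

x∉p-x : x ∉ p - x
x∉p-x x∈p-x = proj₂ (x∈p-y⁻ x∈p-x) refl

p-x∪⁅x⁆≡p : x ∈ p → (p - x) ∪ ⁅ x ⁆ ≡ p
p-x∪⁅x⁆≡p {x = x} {p = p} x∈p = ⊆-antisym ⊆p p⊆
  where
  ⊆p : (p - x) ∪ ⁅ x ⁆ ⊆ p
  ⊆p w∈ with x∈p∪q⁻ (p - x) ⁅ x ⁆ w∈
  ... | inj₁ w∈p-x = proj₁ (x∈p-y⁻ w∈p-x)
  ... | inj₂ w∈⁅x⁆ = subst (_∈ p) (sym (x∈⁅y⁆⇒x≡y x w∈⁅x⁆)) x∈p
  p⊆ : p ⊆ (p - x) ∪ ⁅ x ⁆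
  p⊆ {w} w∈p with w ≟ x
  ... | yes refl = x∈p∪q⁺ (inj₂ (x∈⁅x⁆ x))
  ... | no w≢x = x∈p∪q⁺ (inj₁ (x∈p∧x≢y⇒x∈p-y w∈p w≢x))

p∪⁅x⁆-x≡p : x ∉ p → (p ∪ ⁅ x ⁆) - x ≡ p
p∪⁅x⁆-x≡p {x = x} {p = p} x∉p = ⊆-antisym ⊆p p⊆
  where
  ⊆p : (p ∪ ⁅ x ⁆) - x ⊆ p
  ⊆p w∈ with x∈p-y⁻ w∈
  ... | w∈p∪⁅x⁆ , w≢x with x∈p∪q⁻ p ⁅ x ⁆ w∈p∪⁅x⁆
  ...   | inj₁ w∈p = w∈p
  ...   | inj₂ w∈⁅x⁆ = contradiction (x∈⁅y⁆⇒x≡y x w∈⁅x⁆) w≢x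
  p⊆ : p ⊆ (p ∪ ⁅ x ⁆) - x
  p⊆ w∈p = x∈p∧x≢y⇒x∈p-y (x∈p∪q⁺ (inj₁ w∈p)) λ { refl → x∉p w∈p }

x∈p-y∪⁅z⁆⁻ : x ∈ (p - y) ∪ ⁅ z ⁆ → (x ∈ p × x ≢ y) ⊎ x ≡ z
x∈p-y∪⁅z⁆⁻ {p = p} {y} {z} x∈ with x∈p∪q⁻ (p - y) ⁅ z ⁆ x∈
... | inj₁ x∈p-y = inj₁ (x∈p-y⁻ x∈p-y)
... | inj₂ x∈⁅z⁆ = inj₂ (x∈⁅y⁆⇒x≡y z x∈⁅z⁆)

∣p-y∪⁅z⁆∣≡∣p∣ : y ∈ p → z ∉ p → ∣ (p - y) ∪ ⁅ z ⁆ ∣ ≡ ∣ p ∣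
∣p-y∪⁅z⁆∣≡∣p∣ {y = y} {p = p} {z = z} y∈p z∉p = begin
  ∣ (p - y) ∪ ⁅ z ⁆ ∣ ≡⟨ ∣p∪⁅x⁆∣≡1+∣p∣ (z∉p ∘ proj₁ ∘ x∈p-y⁻) ⟩
  suc ∣ p - y ∣       ≡⟨ sym (∣p∪⁅x⁆∣≡1+∣p∣ (x∉p-x {x = y} {p = p})) ⟩
  ∣ (p - y) ∪ ⁅ y ⁆ ∣ ≡⟨ cong ∣_∣ (p-x∪⁅x⁆≡p y∈p) ⟩
  ∣ p ∣               ∎
  where open ≡-Reasoning

p-y∪⁅z⁆-z∪⁅y⁆≡p : y ∈ p → z ∉ p → (((p - y) ∪ ⁅ z ⁆) - z) ∪ ⁅ y ⁆ ≡ p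
p-y∪⁅z⁆-z∪⁅y⁆≡p {y = y} {p = p} {z = z} y∈p z∉p = begin
  (((p - y) ∪ ⁅ z ⁆) - z) ∪ ⁅ y ⁆ ≡⟨ cong (_∪ ⁅ y ⁆) (p∪⁅x⁆-x≡p (z∉p ∘ proj₁ ∘ x∈p-y⁻)) ⟩
  (p - y) ∪ ⁅ y ⁆               ≡⟨ p-x∪⁅x⁆≡p y∈p ⟩
  p                             ∎
  where open ≡-Reasoning

p-y∪⁅z⁆∩q≡p∩q : y ∉ q → z ∉ q → ((p - y) ∪ ⁅ z ⁆) ∩ q ≡ p ∩ q
p-y∪⁅z⁆∩q≡p∩q {y = y} {q = q} {z = z} {p = p} y∉q z∉q = ⊆-antisym ⊆p∩q p∩q⊆
  where
  ⊆p∩q : ((p - y) ∪ ⁅ z ⁆) ∩ q ⊆ p ∩ q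
  ⊆p∩q x∈ with x∈p∩q⁻ _ q x∈
  ... | x∈p-y∪⁅z⁆ , x∈q with x∈p-y∪⁅z⁆⁻ x∈p-y∪⁅z⁆
  ...   | inj₁ (x∈p , _) = x∈p∩q⁺ (x∈p , x∈q)
  ...   | inj₂ refl = contradiction x∈q z∉q
  p∩q⊆ : p ∩ q ⊆ ((p - y) ∪ ⁅ z ⁆) ∩ q
  p∩q⊆ x∈ with x∈p∩q⁻ p q x∈
  ... | x∈p , x∈q = x∈p∩q⁺ (x∈p∪q⁺ (inj₁ (x∈p∧x≢y⇒x∈p-y x∈p λ { refl → y∉q x∈q })) , x∈q)

∣p-y∪⁅z⁆∩q∣≡1+∣p∩q∣ : y ∉ q → z ∈ q → z ∉ p → ∣ ((p - y) ∪ ⁅ z ⁆) ∩ q ∣ ≡ suc ∣ p ∩ q ∣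
∣p-y∪⁅z⁆∩q∣≡1+∣p∩q∣ {y = y} {q = q} {z = z} {p = p} y∉q z∈q z∉p = begin
  ∣ ((p - y) ∪ ⁅ z ⁆) ∩ q ∣ ≡⟨ cong ∣_∣ (⊆-antisym ⊆p∩q∪⁅z⁆ p∩q∪⁅z⁆⊆) ⟩
  ∣ (p ∩ q) ∪ ⁅ z ⁆ ∣       ≡⟨ ∣p∪⁅x⁆∣≡1+∣p∣ (z∉p ∘ proj₁ ∘ x∈p∩q⁻ p q) ⟩
  suc ∣ p ∩ q ∣             ∎
  where
  open ≡-Reasoning
  ⊆p∩q∪⁅z⁆ : ((p - y) ∪ ⁅ z ⁆) ∩ q ⊆ (p ∩ q) ∪ ⁅ z ⁆
  ⊆p∩q∪⁅z⁆ x∈ with x∈p∩q⁻ _ q x∈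
  ... | x∈p-y∪⁅z⁆ , x∈q with x∈p-y∪⁅z⁆⁻ x∈p-y∪⁅z⁆
  ...   | inj₁ (x∈p , _) = x∈p∪q⁺ (inj₁ (x∈p∩q⁺ (x∈p , x∈q)))
  ...   | inj₂ refl = x∈p∪q⁺ (inj₂ (x∈⁅x⁆ z))
  p∩q∪⁅z⁆⊆ : (p ∩ q) ∪ ⁅ z ⁆ ⊆ ((p - y) ∪ ⁅ z ⁆) ∩ q
  p∩q∪⁅z⁆⊆ x∈ with x∈p∪q⁻ (p ∩ q) ⁅ z ⁆ x∈
  ... | inj₁ x∈p∩q with x∈p∩q⁻ p q x∈p∩q
  ...   | x∈p , x∈q = x∈p∩q⁺ (x∈p∪q⁺ (inj₁ (x∈p∧x≢y⇒x∈p-y x∈p λ { refl → y∉q x∈q })) , x∈q)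
  p∩q∪⁅z⁆⊆ x∈ | inj₂ x∈⁅z⁆ with x∈⁅y⁆⇒x≡y z x∈⁅z⁆
  ...   | refl = x∈p∩q⁺ (x∈p∪q⁺ (inj₂ (x∈⁅x⁆ z)) , z∈q)

x∈⋃⁻ : ∀ (qs : List (Subset m)) → x ∈ ⋃ qs → Any (x ∈_) qs
x∈⋃⁻ [] x∈⊥ = contradiction x∈⊥ ∉⊥
x∈⋃⁻ (q ∷ qs) x∈ with x∈p∪q⁻ q (⋃ qs) x∈
... | inj₁ x∈q = here x∈q
... | inj₂ x∈⋃qs = there (x∈⋃⁻ qs x∈⋃qs)

∣p∩⋃qs∣≡∑∣p∩q∣ : ∀ {m} {p : Subset m} {qs} → AllPairs Disjoint qs →
                 ∣ p ∩ ⋃ qs ∣ ≡ sum (map (λ q → ∣ p ∩ q ∣) qs)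
∣p∩⋃qs∣≡∑∣p∩q∣ {m} {p} [] = trans (cong ∣_∣ (∩-zeroʳ p)) (∣⊥∣≡0 m)
∣p∩⋃qs∣≡∑∣p∩q∣ {p = p} {q ∷ qs} (q#qs ∷ qs-disjoint) = begin
  ∣ p ∩ (q ∪ ⋃ qs) ∣             ≡⟨ cong ∣_∣ (∩-distribˡ-∪ p q (⋃ qs)) ⟩
  ∣ (p ∩ q) ∪ (p ∩ ⋃ qs) ∣       ≡⟨ ∣p∪q∣≡∣p∣+∣q∣ p∩q#p∩⋃qs ⟩
  ∣ p ∩ q ∣ + ∣ p ∩ ⋃ qs ∣       ≡⟨ cong (∣ p ∩ q ∣ +_) (∣p∩⋃qs∣≡∑∣p∩q∣ {p = p} qs-disjoint) ⟩
  ∣ p ∩ q ∣ + sum (map (λ r → ∣ p ∩ r ∣) qs) ∎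
  where
  open ≡-Reasoning
  p∩q#p∩⋃qs : Disjoint (p ∩ q) (p ∩ ⋃ qs)
  p∩q#p∩⋃qs x x∈p∩q x∈p∩⋃qs =
    Allₚ.All¬⇒¬Any (All.map (λ q#r → q#r x (proj₂ (x∈p∩q⁻ p q x∈p∩q))) q#qs)
                   (x∈⋃⁻ qs (proj₂ (x∈p∩q⁻ p (⋃ qs) x∈p∩⋃qs)))

∑∣p∩q∣≡∣p∣⇒p⊆⋃qs : ∀ {qs} → AllPairs Disjoint qs → sum (map (λ q → ∣ p ∩ q ∣) qs) ≡ ∣ p ∣ → p ⊆ ⋃ qs
∑∣p∩q∣≡∣p∣⇒p⊆⋃qs {p = p} {qs} qs-disjoint ∑≡∣p∣ x∈p =
  proj₂ (x∈p∩q⁻ p (⋃ qs) (subst (_ ∈_) (sym p∩⋃qs≡p) x∈p))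
  where
  p∩⋃qs≡p : p ∩ ⋃ qs ≡ p
  p∩⋃qs≡p = p⊆q∧∣q∣≤∣p∣⇒p≡q (p∩q⊆p p (⋃ qs))
              (≤-reflexive (sym (trans (∣p∩⋃qs∣≡∑∣p∩q∣ {p = p} qs-disjoint) ∑≡∣p∣)))

demand : List (A × ℕ) → ℕ
demand cs = sum (map proj₂ cs)

remaining : A → ℕ → List (A × ℕ)
remaining a (suc (suc d)) = [ (a , suc d) ]
remaining a _             = []

∈-remaining⁺ : ∀ {a : A} {b} → 2 ≤ b → (a , b ∸ 1) ∈ₗ remaining a b
∈-remaining⁺ {b = suc zero} (s≤s ())
∈-remaining⁺ {b = suc (suc d)} _ = here refl

∈-remaining⁻ : ∀ {a : A} {b c} → c ∈ₗ remaining a b → 2 ≤ b × c ≡ (a , b ∸ 1)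
∈-remaining⁻ {b = suc (suc d)} (here c≡) = s≤s (s≤s z≤n) , c≡

All-remaining++ : ∀ {P : A × ℕ → Set} {a b rest} →
                  (2 ≤ b → P (a , b ∸ 1)) → All P rest → All P (remaining a b ++ rest)
All-remaining++ {b = zero}          _  P-rest = P-rest
All-remaining++ {b = suc zero}      _  P-rest = P-rest
All-remaining++ {b = suc (suc d)} P-a P-rest = P-a (s≤s (s≤s z≤n)) ∷ P-rest

AllPairs-remaining++ : ∀ {R : A × ℕ → A × ℕ → Set} {a b rest} →
                       (2 ≤ b → All (R (a , b ∸ 1)) rest) → AllPairs R rest → AllPairs R (remaining a b ++ rest)
AllPairs-remaining++ {b = zero}          _  R-rest = R-rest
AllPairs-remaining++ {b = suc zero}      _  R-rest = R-rest
AllPairs-remaining++ {b = suc (suc d)} R-a R-rest = R-a (s≤s (s≤s z≤n)) ∷ R-rest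

demand-remaining++ : ∀ {a : A} {b} rest → 1 ≤ b → 1 + demand (remaining a b ++ rest) ≡ b + demand rest
demand-remaining++ {b = suc zero}    _ _ = refl
demand-remaining++ {b = suc (suc d)} _ _ = refl

anyFin⁻ : ∀ {m} (f : Fin m → Bool) → anyFin f ≡ true → ∃ λ i → f i ≡ true
anyFin⁻ {suc m} f any≡true with f zero in f0≡
... | true = zero , f0≡
... | false with anyFin⁻ (f ∘ suc) any≡true
...   | i , fi≡true = suc i , fi≡true

module _ (G : Graph) where

  ∈N⇒lookup : ∀ {X v} → v ∈ N G X → not (lookup X v) ∧ anyFin (λ u → lookup X u ∧ adj G u v) ≡ true
  ∈N⇒lookup {X} {v} v∈NX = trans (sym (lookup∘tabulate _ v)) ([]=⇒lookup v∈NX)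

  ∈N⇒∉ : ∀ {X v} → v ∈ N G X → v ∉ X
  ∈N⇒∉ {X} v∈NX v∈X with subst (λ s → not s ≡ true) ([]=⇒lookup v∈X) (∧-conicalˡ _ _ (∈N⇒lookup {X} v∈NX))
  ... | ()

  ∈N⇒neighbour : ∀ {X v} → v ∈ N G X → ∃ λ u → u ∈ X × adj G u v ≡ true
  ∈N⇒neighbour {X} v∈NX with anyFin⁻ _ (∧-conicalʳ _ _ (∈N⇒lookup {X} v∈NX))
  ... | u , u∈X∧u~v = u , lookup⇒[]= u X (∧-conicalˡ _ _ u∈X∧u~v) , ∧-conicalʳ _ _ u∈X∧u~v

  Empty-N : ∀ {X} → Empty X → Empty (N G X)
  Empty-N {X} X-empty (v , v∈NX) with ∈N⇒neighbour {X} v∈NX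
  ... | u , u∈X , _ = X-empty (u , u∈X)

  adjacent⇒∉ : ∀ {I u v} → Independent G I → adj G u v ≡ true → u ∈ I → v ∉ I
  adjacent⇒∉ {u = u} {v} I-independent u~v u∈I v∈I with trans (sym u~v) (I-independent u v u∈I v∈I)
  ... | ()

  Independent-⊆ : ∀ {I Z} → Independent G I → Z ⊆ I → Independent G Z
  Independent-⊆ I-independent Z⊆I u v u∈Z v∈Z = I-independent u v (Z⊆I u∈Z) (Z⊆I v∈Z)

  N-Disjoint-independent : ∀ {I X Y} → Independent G I → X ⊆ I → Y ⊆ I → Disjoint (N G X) Y
  N-Disjoint-independent {X = X} I-independent X⊆I Y⊆I w w∈NX w∈Y with ∈N⇒neighbour {X} w∈NX
  ... | u , u∈X , u~w = adjacent⇒∉ I-independent u~w (X⊆I u∈X) (Y⊆I w∈Y)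

  module _ (k : ℕ) (S : Subset (n G)) (J : ℕ → Subset (n G)) where

    -- Constraint sets are predicates; to count tokens we list their members.
    record Layout (i : ℕ) (C : ConstraintSet G) (cs : List (Constraint G)) : Set where
      field
        C⊆cs     : ∀ {c} → C c → c ∈ₗ cs
        cs⊆C     : ∀ {c} → c ∈ₗ cs → C c
        disjoint : AllPairs (Disjoint on proj₁) cs
        within   : All (λ c → proj₁ c ⊆ J i) cs
        positive : All (λ c → 1 ≤ proj₂ c) cs
        total    : demand cs ≡ k

      covers : ∀ {Z} → satisfiesSet G Z C → ∣ Z ∣ ≡ k → ∀ {z} → z ∈ Z → Any (λ c → z ∈ proj₁ c) cs
      covers {Z} Z-sat ∣Z∣≡k z∈Z =
        Anyₚ.map⁻ (x∈⋃⁻ (map proj₁ cs) (∑∣p∩q∣≡∣p∣⇒p⊆⋃qs (AllPairsₚ.map⁺ disjoint) ∑≡∣Z∣ z∈Z))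
        where
        ∑≡∣Z∣ : sum (map (λ q → ∣ Z ∩ q ∣) (map proj₁ cs)) ≡ ∣ Z ∣
        ∑≡∣Z∣ = begin
          sum (map (λ q → ∣ Z ∩ q ∣) (map proj₁ cs)) ≡⟨ cong sum (sym (map-∘ cs)) ⟩
          sum (map (λ c → ∣ Z ∩ proj₁ c ∣) cs)
            ≡⟨ cong sum (map-cong-local (All.tabulate (Z-sat _ ∘ cs⊆C))) ⟩
          demand cs                                  ≡⟨ trans total (sym ∣Z∣≡k) ⟩
          ∣ Z ∣                                      ∎
          where open ≡-Reasoning

    open Layout

    Infeasible : ConstraintSet G → Set
    Infeasible C = ∃ λ c → C c × Empty (proj₁ c) × 1 ≤ proj₂ c

    Reaches : ℕ → ConstraintSet G → Set
    Reaches i C = ∀ Z → Z ⊆ J i → ∣ Z ∣ ≡ k → satisfiesSet G Z C → Reachable G S Z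

    Infeasible⇒unsatisfiable : ∀ {C Z} → Infeasible C → ¬ satisfiesSet G Z C
    Infeasible⇒unsatisfiable {Z = Z} ((X , b) , c∈C , X-empty , 1≤b) Z-sat = <-irrefl refl (begin-strict
      0         <⟨ 1≤b ⟩
      b         ≡⟨ sym (Z-sat _ c∈C) ⟩
      ∣ Z ∩ X ∣ ≤⟨ ∣p∩q∣≤∣q∣ Z X ⟩
      ∣ X ∣     ≡⟨ Empty⇒∣p∣≡0 X-empty ⟩
      0         ∎)
      where open ≤-Reasoning

    Infeasible⇒Reaches : ∀ {i C} → Infeasible C → Reaches i C
    Infeasible⇒Reaches C-infeasible Z _ _ Z-sat =
      contradiction Z-sat (Infeasible⇒unsatisfiable {Z = Z} C-infeasible)

    Layout-resp-↭ : ∀ {i C cs ds} → cs ↭ ds → Layout i C cs → Layout i C ds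
    Layout-resp-↭ cs↭ds L = record
      { C⊆cs     = ∈-resp-↭ cs↭ds ∘ C⊆cs L
      ; cs⊆C     = cs⊆C L ∘ ∈-resp-↭ (↭-sym cs↭ds)
      ; disjoint = PermutationSetoid.AllPairs-resp-↭ (setoid _) Disjoint-sym (resp₂ _) (↭⇒↭ₛ cs↭ds)
                                                     (disjoint L)
      ; within   = All-resp-↭ cs↭ds (within L)
      ; positive = All-resp-↭ cs↭ds (positive L)
      ; total    = trans (sym (sum-↭ (map⁺ proj₂ cs↭ds))) (total L)
      }

    focus : ∀ {i C cs c} → Layout i C cs → c ∈ₗ cs → ∃ λ rest → Layout i C (c ∷ rest)
    focus {c = c} L c∈cs with ∈-∃++ c∈cs
    ... | before , after , refl = before ++ after , Layout-resp-↭ (shift c before after) L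

    base-Layout : 1 ≤ k → J 0 ≡ S → Layout 0 (_≡ (S , k)) [ (S , k) ]
    base-Layout 1≤k J0≡S = record
      { C⊆cs     = here
      ; cs⊆C     = λ { (here c≡Sk) → c≡Sk }
      ; disjoint = [] ∷ []
      ; within   = (λ x∈S → subst (_ ∈_) (sym J0≡S) x∈S) ∷ []
      ; positive = 1≤k ∷ []
      ; total    = +-identityʳ k
      }

    base-Reaches : J 0 ≡ S → ∣ S ∣ ≡ k → Reaches 0 (_≡ (S , k))
    base-Reaches J0≡S ∣S∣≡k Z Z⊆J0 ∣Z∣≡k _ =
      subst (Reachable G S) (sym (p⊆q∧∣q∣≤∣p∣⇒p≡q Z⊆S (≤-reflexive (trans ∣S∣≡k (sym ∣Z∣≡k))))) ε
      where
      Z⊆S : Z ⊆ S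
      Z⊆S z∈Z = subst (_ ∈_) J0≡S (Z⊆J0 z∈Z)

    restrict : Subset (n G) → Constraint G → Constraint G
    restrict T c = proj₁ c ∩ T , proj₂ c

    demand-restrict : ∀ T cs → demand (map (restrict T) cs) ≡ demand cs
    demand-restrict T cs = cong sum (sym (map-∘ cs))

    branched : Subset (n G) → Subset (n G) → ℕ → List (Constraint G) → List (Constraint G)
    branched T X b rest = (N G X ∩ T , 1) ∷ map (restrict T) (remaining X b ++ rest)

    module Branching {i C X b rest} (Ji-independent : Independent G (J i)) {x} (x∈X : x ∈ X)
                     (L : Layout i C ((X , b) ∷ rest)) where

      J′ : Subset (n G)
      J′ = J (suc i)

      C′ : ConstraintSet G
      C′ = branch G J′ C (X , b)

      carried : List (Constraint G)
      carried = remaining X b ++ rest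

      cs′ : List (Constraint G)
      cs′ = branched J′ X b rest

      X#rest : All (λ c → Disjoint X (proj₁ c)) rest
      X#rest = AllPairs.head (disjoint L)

      X⊆Ji : X ⊆ J i
      X⊆Ji = All.head (within L)

      rest⊆Ji : All (λ c → proj₁ c ⊆ J i) rest
      rest⊆Ji = All.tail (within L)

      1≤b : 1 ≤ b
      1≤b = All.head (positive L)

      ∈rest⇒≢ : ∀ {c} → c ∈ₗ rest → c ≢ (X , b)
      ∈rest⇒≢ c∈rest refl = All.lookup X#rest c∈rest x x∈X x∈X

      carried⊆Ji : All (λ c → proj₁ c ⊆ J i) carried
      carried⊆Ji = All-remaining++ (λ _ → X⊆Ji) rest⊆Ji

      C′⊆cs′ : ∀ {c} → C′ c → c ∈ₗ cs′
      C′⊆cs′ (inj₁ refl) = here refl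
      C′⊆cs′ (inj₂ (inj₁ (2≤b , refl))) = there (∈-map⁺ (restrict J′) (∈-++⁺ˡ (∈-remaining⁺ 2≤b)))
      C′⊆cs′ (inj₂ (inj₂ (c , c∈C , c≢Xb , refl))) with C⊆cs L c∈C
      ... | here c≡Xb = contradiction c≡Xb c≢Xb
      ... | there c∈rest = there (∈-map⁺ (restrict J′) (∈-++⁺ʳ (remaining X b) c∈rest))

      cs′⊆C′ : ∀ {c} → c ∈ₗ cs′ → C′ c
      cs′⊆C′ (here refl) = inj₁ refl
      cs′⊆C′ (there c∈) with ∈-map⁻ (restrict J′) c∈
      ... | c₀ , c₀∈ , refl with ∈-++⁻ (remaining X b) c₀∈
      ...   | inj₂ c₀∈rest = inj₂ (inj₂ (c₀ , cs⊆C L (there c₀∈rest) , ∈rest⇒≢ c₀∈rest , refl))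
      ...   | inj₁ c₀∈remaining with ∈-remaining⁻ c₀∈remaining
      ...     | 2≤b , refl = inj₂ (inj₁ (2≤b , refl))

      layout : Layout (suc i) C′ cs′
      layout = record
        { C⊆cs     = C′⊆cs′
        ; cs⊆C     = cs′⊆C′
        ; disjoint =
            Allₚ.map⁺ (All.map (λ {c} → NX#Y {c}) carried⊆Ji) ∷ AllPairsₚ.map⁺ (AllPairs.map Disjoint-∩ carried-disjoint)
        ; within   = p∩q⊆q _ _ ∷ Allₚ.map⁺ (All.tabulate λ _ → p∩q⊆q _ _)
        ; positive = s≤s z≤n ∷ Allₚ.map⁺ (All-remaining++ (λ { (s≤s 1≤b∸1) → 1≤b∸1 }) (All.tail (positive L)))
        ; total    = begin
            1 + demand (map (restrict J′) carried) ≡⟨ cong suc (demand-restrict J′ carried) ⟩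
            1 + demand carried                    ≡⟨ demand-remaining++ rest 1≤b ⟩
            b + demand rest                       ≡⟨ total L ⟩
            k                                     ∎
        }
        where
        open ≡-Reasoning
        NX#Y : ∀ {c} → proj₁ c ⊆ J i → Disjoint (N G X ∩ J′) (proj₁ c ∩ J′)
        NX#Y {c} Y⊆Ji = Disjoint-∩ (N-Disjoint-independent {Y = proj₁ c} Ji-independent X⊆Ji Y⊆Ji)
        carried-disjoint : AllPairs (Disjoint on proj₁) carried
        carried-disjoint = AllPairs-remaining++ (λ _ → X#rest) (AllPairs.tail (disjoint L))

      module Predecessor (J′-independent : Independent G J′) {Z} (Z⊆J′ : Z ⊆ J′) (∣Z∣≡k : ∣ Z ∣ ≡ k)
                         (Z-sat : satisfiesSet G Z C′) where

        covered : ∀ {z} → z ∈ Z → Any (λ c → z ∈ proj₁ c) cs′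
        covered = covers layout Z-sat ∣Z∣≡k

        ∣Z∩NX∣≡1 : ∣ Z ∩ (N G X ∩ J′) ∣ ≡ 1
        ∣Z∩NX∣≡1 = Z-sat _ (inj₁ refl)

        token : Nonempty (Z ∩ (N G X ∩ J′))
        token = ∣p∣>0⇒Nonempty (≤-reflexive (sym ∣Z∩NX∣≡1))

        v : Fin (n G)
        v = proj₁ token

        v∈Z : v ∈ Z
        v∈Z = proj₁ (x∈p∩q⁻ Z _ (proj₂ token))

        v∈NX : v ∈ N G X
        v∈NX = proj₁ (x∈p∩q⁻ (N G X) J′ (proj₂ (x∈p∩q⁻ Z _ (proj₂ token))))

        only-v : ∀ {z} → z ∈ Z → z ∈ N G X → z ≡ v
        only-v z∈Z z∈NX = ∣p∣≡1⇒x∈p∧y∈p⇒x≡y ∣Z∩NX∣≡1 (x∈p∩q⁺ (z∈Z , x∈p∩q⁺ (z∈NX , Z⊆J′ z∈Z))) (proj₂ token)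

        neighbour : ∃ λ u → u ∈ X × adj G u v ≡ true
        neighbour = ∈N⇒neighbour {X} v∈NX

        u : Fin (n G)
        u = proj₁ neighbour

        u∈X : u ∈ X
        u∈X = proj₁ (proj₂ neighbour)

        u~v : adj G u v ≡ true
        u~v = proj₂ (proj₂ neighbour)

        u∉Z : u ∉ Z
        u∉Z u∈Z = adjacent⇒∉ J′-independent u~v (Z⊆J′ u∈Z) (Z⊆J′ v∈Z)

        u∉rest : ∀ {c} → c ∈ₗ rest → u ∉ proj₁ c
        u∉rest c∈rest = All.lookup X#rest c∈rest u u∈X

        v∉rest : ∀ {c} → c ∈ₗ rest → v ∉ proj₁ c
        v∉rest c∈rest = adjacent⇒∉ Ji-independent u~v (X⊆Ji u∈X) ∘ All.lookup rest⊆Ji c∈rest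

        Z′ : Subset (n G)
        Z′ = (Z - v) ∪ ⁅ u ⁆

        Z′⊆Ji : Z′ ⊆ J i
        Z′⊆Ji z∈Z′ with x∈p-y∪⁅z⁆⁻ z∈Z′
        ... | inj₂ z≡u = subst (_∈ J i) (sym z≡u) (X⊆Ji u∈X)
        ... | inj₁ (z∈Z , z≢v) with covered z∈Z
        ...   | here z∈NX∩J′ = contradiction (only-v z∈Z (proj₁ (x∈p∩q⁻ _ J′ z∈NX∩J′))) z≢v
        ...   | there z∈restricted =
                All.lookupWith (λ Y⊆Ji z∈Y∩J′ → Y⊆Ji (proj₁ (x∈p∩q⁻ _ J′ z∈Y∩J′)))
                               carried⊆Ji (Anyₚ.map⁻ z∈restricted)

        ∣Z′∣≡k : ∣ Z′ ∣ ≡ k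
        ∣Z′∣≡k = trans (∣p-y∪⁅z⁆∣≡∣p∣ v∈Z u∉Z) ∣Z∣≡k

        -- Only the constraint (X ∩ J′ , b ∸ 1), present when b ≥ 2, can cover a token of Z in X.
        Z∩X⇒2≤b : ∀ {z} → z ∈ Z → z ∈ X → 2 ≤ b
        Z∩X⇒2≤b z∈Z z∈X with covered z∈Z
        ... | here z∈NX∩J′ = contradiction z∈X (∈N⇒∉ {X} (proj₁ (x∈p∩q⁻ _ J′ z∈NX∩J′)))
        ... | there z∈restricted with Anyₚ.++⁻ (remaining X b) (Anyₚ.map⁻ z∈restricted)
        ...   | inj₁ z∈remaining = proj₁ (∈-remaining⁻ (proj₁ (proj₂ (find z∈remaining))))
        ...   | inj₂ z∈rest with find z∈rest
        ...     | c , c∈rest , z∈Y∩J′ =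
                  contradiction (proj₁ (x∈p∩q⁻ _ J′ z∈Y∩J′)) (All.lookup X#rest c∈rest _ z∈X)

        ∣Z∩X∣≡b∸1 : ∣ Z ∩ X ∣ ≡ b ∸ 1
        ∣Z∩X∣≡b∸1 with 2 ≤? b
        ... | yes 2≤b = trans (cong ∣_∣ (sym (p⊆r⇒p∩[q∩r]≡p∩q Z⊆J′))) (Z-sat _ (inj₂ (inj₁ (2≤b , refl))))
        ... | no 2≰b = trans (Empty⇒∣p∣≡0 λ (z , z∈Z∩X) → 2≰b (uncurry Z∩X⇒2≤b (x∈p∩q⁻ Z X z∈Z∩X)))
                             (sym (m≤n⇒m∸n≡0 (≤-pred (≰⇒> 2≰b))))

        Z′-sat : satisfiesSet G Z′ C
        Z′-sat c c∈C with C⊆cs L c∈C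
        ... | here refl = begin
          ∣ Z′ ∩ X ∣     ≡⟨ ∣p-y∪⁅z⁆∩q∣≡1+∣p∩q∣ (∈N⇒∉ {X} v∈NX) u∈X u∉Z ⟩
          suc ∣ Z ∩ X ∣  ≡⟨ cong suc ∣Z∩X∣≡b∸1 ⟩
          suc (b ∸ 1)    ≡⟨ m+[n∸m]≡n 1≤b ⟩
          b              ∎
          where open ≡-Reasoning
        ... | there c∈rest = begin
          ∣ Z′ ∩ proj₁ c ∣         ≡⟨ cong ∣_∣ (p-y∪⁅z⁆∩q≡p∩q {p = Z} (v∉rest c∈rest) (u∉rest c∈rest)) ⟩
          ∣ Z ∩ proj₁ c ∣          ≡⟨ cong ∣_∣ (sym (p⊆r⇒p∩[q∩r]≡p∩q Z⊆J′)) ⟩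
          ∣ Z ∩ (proj₁ c ∩ J′) ∣   ≡⟨ Z-sat _ (inj₂ (inj₂ (c , c∈C , ∈rest⇒≢ c∈rest , refl))) ⟩
          proj₂ c                  ∎
          where open ≡-Reasoning

        v∉Z′ : v ∉ Z′
        v∉Z′ v∈Z′ with x∈p-y∪⁅z⁆⁻ v∈Z′
        ... | inj₁ (_ , v≢v) = v≢v refl
        ... | inj₂ v≡u = u∉Z (subst (_∈ Z) v≡u v∈Z)

        slide : Slide G Z′ Z
        slide = u , v , x∈p∪q⁺ (inj₂ (x∈⁅x⁆ u)) , v∉Z′ , u~v , sym (p-y∪⁅z⁆-z∪⁅y⁆≡p v∈Z u∉Z) ,
                Independent-⊆ J′-independent Z⊆J′

      reaches : Independent G J′ → Reaches i C → Reaches (suc i) C′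
      reaches J′-independent Z-reachable Z Z⊆J′ ∣Z∣≡k Z-sat =
        Z-reachable Z′ Z′⊆Ji ∣Z′∣≡k Z′-sat ◅◅ (slide ◅ ε)
        where open Predecessor J′-independent Z⊆J′ ∣Z∣≡k Z-sat

    Infeasible-branch-Empty : ∀ {T C X b} → Empty X → Infeasible (branch G T C (X , b))
    Infeasible-branch-Empty {T} {X = X} X-empty =
      (N G X ∩ T , 1) , inj₁ refl , Empty-∩ (Empty-N X-empty) , s≤s z≤n

    Infeasible-branch : ∀ {T C X b x} → x ∈ X → Infeasible C → Infeasible (branch G T C (X , b))
    Infeasible-branch {T} {x = x} x∈X ((Y , d) , c∈C , Y-empty , 1≤d) =
      (Y ∩ T , d) , inj₂ (inj₂ ((Y , d) , c∈C , (λ { refl → Y-empty (x , x∈X) }) , refl)) ,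
      Empty-∩ Y-empty , 1≤d

    invariant : ∀ {i C} → 1 ≤ k → J 0 ≡ S → ∣ S ∣ ≡ k → (∀ {j} → j ≤ i → Independent G (J j)) →
                𝒞 G J S k i C → (∃ (Layout i C) ⊎ Infeasible C) × Reaches i C
    invariant 1≤k J0≡S ∣S∣≡k _ base = inj₁ (_ , base-Layout 1≤k J0≡S) , base-Reaches J0≡S ∣S∣≡k
    invariant 1≤k J0≡S ∣S∣≡k J-independent (step (X , b) C∈𝒞 c∈C)
      with invariant 1≤k J0≡S ∣S∣≡k (λ j≤i → J-independent (m≤n⇒m≤1+n j≤i)) C∈𝒞 | nonempty? X
    ... | _ | no X-empty =
      inj₂ (Infeasible-branch-Empty X-empty) , Infeasible⇒Reaches (Infeasible-branch-Empty X-empty)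
    ... | inj₂ C-infeasible , _ | yes (x , x∈X) =
      inj₂ (Infeasible-branch x∈X C-infeasible) , Infeasible⇒Reaches (Infeasible-branch x∈X C-infeasible)
    ... | inj₁ (cs , L) , C-reaches | yes (x , x∈X) with focus L (C⊆cs L c∈C)
    ...   | rest , L′ = inj₁ (_ , layout) , reaches (J-independent ≤-refl) C-reaches
      where open Branching (J-independent (m≤n⇒m≤1+n ≤-refl)) x∈X L′

lemma3p5 : (G : Graph) (k ℓ : ℕ) → 1 ≤ k → 1 ≤ ℓ →
    (S : Subset (n G)) → Independent G S → ∣ S ∣ ≡ k →
    (J : ℕ → Subset (n G)) → J 0 ≡ S → (∀ j → j ≤ ℓ → Independent G (J j)) →
    ∀ i → i ≤ ℓ →
    (Z : Subset (n G)) → Independent G Z → Z ⊆ J i → ∣ Z ∣ ≡ k →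
    Σ (ConstraintSet G) (λ C → 𝒞 G J S k i C × satisfiesSet G Z C) →
    Reachable G S Z
lemma3p5 G k ℓ 1≤k _ S _ ∣S∣≡k J J0≡S J-independent i i≤ℓ Z _ Z⊆Ji ∣Z∣≡k (C , C∈𝒞 , Z-sat) =
  proj₂ (invariant G k S J 1≤k J0≡S ∣S∣≡k (λ j≤i → J-independent _ (≤-trans j≤i i≤ℓ)) C∈𝒞) Z Z⊆Ji ∣Z∣≡k Z-sat
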